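{- Let $G$ be a graph and $\alpha\ge 0$ an integer, and let $\mathcal{H}(G)$ be the injective hull of $G$. Then $G$ is $\alpha$-weakly-Helly if and only if for every vertex $h\in V(\mathcal{H}(G))$ there is a real vertex $v\in V(G)$ with $d_{\mathcal{H}(G)}(h,v)\le\alpha$.
   Context: All graphs are finite, simple, undirected, unweighted and connected. $D_G(v,r)=\{u\in V(G): d_G(u,v)\le r\}$ is the disk of radius $r$ around $v$. A graph $G$ is $\alpha$-weakly-Helly if for every family of disks $\{D_G(v,r(v)) : v\in S\}$, $S\subseteq V(G)$, that pairwise intersect, the disks $D_G(v,r(v)+\alpha)$, $v\in S$, have a common vertex; Helly graphs are the $0$-weakly-Helly graphs. The injective hull $\mathcal{H}(G)$ is the (unique) minimal Helly graph containing $G$ as an isometric subgraph; concretely its vertices are the functions $f:V(G)\to\mathbb{Z}_{\ge 0}$ with $f(x)+f(y)\ge d_G(x,y)$ for all $x,y$ and such that for every $x$ there is $y$ with $f(x)+f(y)=d_G(x,y)$; two such functions are adjacent iff $\max_{x}|f(x)-g(x)|=1$ (so distances are $\max_x|f(x)-g(x)|$), and $G$ is embedded isometrically by $z\mapsto d_G(z,\cdot)$. The images of vertices of $G$ are called real vertices and are identified with $V(G)$; the other vertices of $\mathcal{H}(G)$ are Helly vertices. -}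

module Defs where

open import Data.Nat using (ℕ; zero; suc; _+_; _≤_; _⊔_; ∣_-_∣)
open import Data.Fin using (Fin)
open import Data.Fin.Subset using (Subset; _∈_)
open import Data.List using (List; foldr; map; allFin)
open import Data.Product using (Σ; ∃; ∃-syntax; _×_)
open import Relation.Nullary using (¬_)
open import Relation.Binary.PropositionalEquality using (_≡_)
open import Level using (0ℓ) renaming (suc to lsuc)

record Graph (n : ℕ) : Set₁ where
  field
    Adj     : Fin n → Fin n → Set
    sym     : ∀ {u v} → Adj u v → Adj v u
    irrefl  : ∀ {u} → ¬ Adj u u

open Graph public

data Walk {n : ℕ} (G : Graph n) : ℕ → Fin n → Fin n → Set where
  nil  : ∀ {u} → Walk G 0 u u
  cons : ∀ {k u w v} → Adj G u w → Walk G k w v → Walk G (suc k) u v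

Connected : ∀ {n} → Graph n → Set
Connected G = ∀ u v → ∃[ k ] Walk G k u v

IsDistance : ∀ {n} → Graph n → (Fin n → Fin n → ℕ) → Set
IsDistance G d = ∀ u v → Walk G (d u v) u v × (∀ k → Walk G k u v → d u v ≤ k)

InDisk : ∀ {n} → (Fin n → Fin n → ℕ) → Fin n → ℕ → Fin n → Set
InDisk d v r u = d v u ≤ r

WeaklyHelly : ∀ {n} → (Fin n → Fin n → ℕ) → ℕ → Set
WeaklyHelly {n} d α =
  ∀ (S : Subset n) (r : Fin n → ℕ) →
  (∀ u v → u ∈ S → v ∈ S → ∃[ w ] (InDisk d u (r u) w × InDisk d v (r v) w)) →
  ∃[ w ] (∀ v → v ∈ S → InDisk d v (r v + α) w)

record HullVertex {n : ℕ} (d : Fin n → Fin n → ℕ) : Set where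
  field
    f     : Fin n → ℕ
    lower : ∀ x y → d x y ≤ f x + f y
    tight : ∀ x → ∃[ y ] (f x + f y ≡ d x y)

open HullVertex public

supDist : ∀ {n} → (Fin n → ℕ) → (Fin n → ℕ) → ℕ
supDist {n} f g = foldr _⊔_ 0 (map (λ x → ∣ f x - g x ∣) (allFin n))

-- Distance in H(G) between a hull vertex h and the real vertex v (embedded as d v ·).
hullDistToReal : ∀ {n} {d : Fin n → Fin n → ℕ} → HullVertex d → Fin n → ℕ
hullDistToReal {d = d} h v = supDist (f h) (d v)

module Submission where

-- The key fact about H(G) is a "tightening" lemma: every function g with
-- d x y ≤ g x + g y for all x, y lies pointwise above some hull vertex.  If
-- some coordinate x has no tight partner y (g x + g y = d x y), it can be
-- lowered by one without breaking the inequalities; since the sum of the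
-- values decreases, this terminates at a hull vertex.
--
-- (⇒) For a hull vertex h the disks D(v, h v) pairwise meet, because the graph
--     metric is geodesic and d u v ≤ h u + h v.  Weak Hellyness yields a w
--     with d v w ≤ h v + α for all v, and tightness of h then forces
--     |h x - d w x| ≤ α for every x.
-- (⇐) Given pairwise meeting disks D(v, r v), v ∈ S, the radii (extended by a
--     large value outside S) form such a function g.  Tightening gives a hull
--     vertex h ≤ g, and a real vertex within distance α of h lies in every
--     disk D(v, r v + α).

open import Defs
open import Data.Nat using (ℕ; _≤_)
open import Data.Fin using (Fin)
open import Data.Product using (∃-syntax)
open import Function.Bundles using (_⇔_)

open import Data.Nat using (zero; suc; _+_; _∸_; _<_; _⊔_; ∣_-_∣; z≤n; s≤s; pred; _≤?_)
open import Data.Nat.Properties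
open import Data.Fin using (zero; suc) renaming (_≟_ to _≟ᶠ_)
open import Data.Fin.Properties using (any?; all?; ¬∀⟶∃¬)
open import Data.Fin.Subset using (Subset; _∈_; ⊤)
open import Data.Fin.Subset.Properties using (_∈?_; ∈⊤)
open import Data.List using (List; []; _∷_; foldr; map; allFin)
import Data.List.Membership.Propositional as List
open import Data.List.Membership.Propositional.Properties using (∈-allFin)
open import Data.List.Relation.Unary.Any using (here; there)
open import Data.Vec.Functional using (updateAt)
open import Data.Vec.Functional.Properties using (updateAt-updates; updateAt-minimal)
open import Data.Product using (Σ; _×_; _,_; proj₁; proj₂)
open import Data.Sum using (inj₁; inj₂)
open import Relation.Nullary using (¬_; yes; no; Dec; contradiction)
open import Relation.Binary.PropositionalEquality
  using (_≡_; _≢_; refl; trans; cong; cong₂; subst; subst₂) renaming (sym to ≡-sym)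
open import Function.Bundles using (mk⇔)

module Walks {n : ℕ} (G : Graph n) where

  snoc : ∀ {k u w v} → Walk G k u w → Adj G w v → Walk G (suc k) u v
  snoc nil        e = cons e nil
  snoc (cons a p) e = cons a (snoc p e)

  reverse : ∀ {k u v} → Walk G k u v → Walk G k v u
  reverse nil        = nil
  reverse (cons a p) = snoc (reverse p) (Graph.sym G a)

  _++ʷ_ : ∀ {j k u w v} → Walk G j u w → Walk G k w v → Walk G (j + k) u v
  nil      ++ʷ q = q
  cons a p ++ʷ q = cons a (p ++ʷ q)

  splitAt : ∀ {k u v} → Walk G k u v → ∀ j → j ≤ k →
            ∃[ w ] (Walk G j u w × Walk G (k ∸ j) w v)
  splitAt {u = u} p          zero    _         = u , nil , p
  splitAt         (cons a p) (suc j) (s≤s j≤k) with splitAt p j j≤k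
  ... | w , prefix , suffix = w , cons a prefix , suffix

module ShortestPaths {n : ℕ} (G : Graph n) (d : Fin n → Fin n → ℕ) (isD : IsDistance G d) where
  open Walks G

  geodesic : ∀ u v → Walk G (d u v) u v
  geodesic u v = proj₁ (isD u v)

  walk-bound : ∀ {k u v} → Walk G k u v → d u v ≤ k
  walk-bound p = proj₂ (isD _ _) _ p

  dist-self : ∀ u → d u u ≡ 0
  dist-self u = n≤0⇒n≡0 (walk-bound nil)

  dist-sym : ∀ u v → d u v ≡ d v u
  dist-sym u v = ≤-antisym (walk-bound (reverse (geodesic v u)))
                           (walk-bound (reverse (geodesic u v)))

  triangle : ∀ u w v → d u v ≤ d u w + d w v
  triangle u w v = walk-bound (geodesic u w ++ʷ geodesic w v)

  -- Walk a distance of a along a geodesic from u to v (or stop at v).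
  disks-meet : ∀ u v a b → d u v ≤ a + b → ∃[ w ] (d u w ≤ a × d v w ≤ b)
  disks-meet u v a b uv≤a+b with a ≤? d u v
  ... | no  a≰uv = v , ≰⇒≥ a≰uv , subst (_≤ b) (≡-sym (dist-self v)) z≤n
  ... | yes a≤uv with splitAt (geodesic u v) a a≤uv
  ...   | w , prefix , suffix =
          w , walk-bound prefix
            , subst (_≤ b) (dist-sym w v)
                (≤-trans (walk-bound suffix) (m≤n+o⇒m∸n≤o (d u v) a uv≤a+b))

∣-∣≤⇒≤+ : ∀ {a b α} → ∣ a - b ∣ ≤ α → b ≤ a + α
∣-∣≤⇒≤+ {a} {b} le = ≤-trans (m≤n+∣n-m∣ b a) (+-monoʳ-≤ a le)

≤+⇒∣-∣≤ : ∀ {a b α} → a ≤ b + α → b ≤ a + α → ∣ a - b ∣ ≤ α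
≤+⇒∣-∣≤ {a} {b} a≤b+α b≤a+α with ∣m-n∣≡[m∸n]∨[n∸m] a b
... | inj₁ eq rewrite eq = m≤n+o⇒m∸n≤o a b a≤b+α
... | inj₂ eq rewrite eq = m≤n+o⇒m∸n≤o b a b≤a+α

max-≤ : ∀ {A : Set} (h : A → ℕ) {α} (xs : List A) →
        (∀ x → h x ≤ α) → foldr _⊔_ 0 (map h xs) ≤ α
max-≤ h []       bound = z≤n
max-≤ h (x ∷ xs) bound = ⊔-lub (bound x) (max-≤ h xs bound)

≤-max : ∀ {A : Set} (h : A → ℕ) {x} (xs : List A) →
        x List.∈ xs → h x ≤ foldr _⊔_ 0 (map h xs)
≤-max h (y ∷ xs) (here refl) = m≤m⊔n _ _
≤-max h (y ∷ xs) (there x∈) = ≤-trans (≤-max h xs x∈) (m≤n⊔m _ _)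

supDist-≤ : ∀ {n} (f g : Fin n → ℕ) {α} →
            (∀ x → ∣ f x - g x ∣ ≤ α) → supDist f g ≤ α
supDist-≤ {n} f g = max-≤ (λ x → ∣ f x - g x ∣) (allFin n)

supDist-≥ : ∀ {n} (f g : Fin n → ℕ) {α} →
            supDist f g ≤ α → ∀ x → ∣ f x - g x ∣ ≤ α
supDist-≥ {n} f g le x = ≤-trans (≤-max (λ x → ∣ f x - g x ∣) (allFin n) (∈-allFin x)) le

-- Sums over Fin n; used as the termination measure of tightening and as a
-- uniform upper bound on distances.
sumFin : ∀ {n} → (Fin n → ℕ) → ℕ
sumFin {zero}  g = 0
sumFin {suc n} g = g zero + sumFin (λ i → g (suc i))

≤-sumFin : ∀ {n} (g : Fin n → ℕ) x → g x ≤ sumFin g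
≤-sumFin g zero    = m≤m+n _ _
≤-sumFin g (suc x) = ≤-trans (≤-sumFin (λ i → g (suc i)) x) (m≤n+m _ _)

sumFin-mono : ∀ {n} (g h : Fin n → ℕ) → (∀ i → g i ≤ h i) → sumFin g ≤ sumFin h
sumFin-mono {zero}  g h g≤h = z≤n
sumFin-mono {suc n} g h g≤h =
  +-mono-≤ (g≤h zero) (sumFin-mono (λ i → g (suc i)) (λ i → h (suc i)) (λ i → g≤h (suc i)))

sumFin-mono-< : ∀ {n} (g h : Fin n → ℕ) → (∀ i → g i ≤ h i) →
                ∀ x → g x < h x → sumFin g < sumFin h
sumFin-mono-< g h g≤h zero    lt =
  +-mono-<-≤ lt (sumFin-mono (λ i → g (suc i)) (λ i → h (suc i)) (λ i → g≤h (suc i)))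
sumFin-mono-< g h g≤h (suc x) lt =
  +-mono-≤-< (g≤h zero) (sumFin-mono-< (λ i → g (suc i)) (λ i → h (suc i)) (λ i → g≤h (suc i)) x lt)

pred-< : ∀ {m} → m ≢ 0 → pred m < m
pred-< {zero}  0≢0 = contradiction refl 0≢0
pred-< {suc m} _   = n<1+n m

pred-+ : ∀ a b → pred (a + b) ≤ pred a + b
pred-+ zero    b = pred[n]≤n
pred-+ (suc a) b = ≤-refl

module Tightening {n : ℕ} (d : Fin n → Fin n → ℕ)
                  (dist-self : ∀ x → d x x ≡ 0)
                  (dist-sym : ∀ x y → d x y ≡ d y x) where

  Dominating : (Fin n → ℕ) → Set
  Dominating g = ∀ x y → d x y ≤ g x + g y

  Tight : (Fin n → ℕ) → Fin n → Set
  Tight g x = ∃[ y ] (g x + g y ≡ d x y)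

  tight? : ∀ g x → Dec (Tight g x)
  tight? g x = any? (λ y → g x + g y ≟ d x y)

  lowerAt : (Fin n → ℕ) → Fin n → Fin n → ℕ
  lowerAt g x = updateAt g x pred

  lowerAt-≤ : ∀ g x y → lowerAt g x y ≤ g y
  lowerAt-≤ g x y with y ≟ᶠ x
  ... | yes refl = subst (_≤ g x) (≡-sym (updateAt-updates x g)) pred[n]≤n
  ... | no  y≢x  = ≤-reflexive (updateAt-minimal y x g y≢x)

  -- A coordinate with value 0 is its own tight partner.
  nonTight⇒nonZero : ∀ g x → ¬ Tight g x → g x ≢ 0
  nonTight⇒nonZero g x ¬tight gx≡0 =
    ¬tight (x , subst (λ m → m + m ≡ d x x) (≡-sym gx≡0) (≡-sym (dist-self x)))

  slack : ∀ g x → Dominating g → ¬ Tight g x → ∀ y → d x y ≤ pred (g x) + g y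
  slack g x dom ¬tight y =
    ≤-trans (<⇒≤pred (≤∧≢⇒< (dom x y) (λ eq → ¬tight (y , ≡-sym eq)))) (pred-+ (g x) (g y))

  lowerAt-dominating : ∀ g x → Dominating g → ¬ Tight g x → Dominating (lowerAt g x)
  lowerAt-dominating g x dom ¬tight a b = cases (a ≟ᶠ x) (b ≟ᶠ x)
    where
    g′ : Fin n → ℕ
    g′ = lowerAt g x
    at-x : g′ x ≡ pred (g x)
    at-x = updateAt-updates x g
    off-x : ∀ y → y ≢ x → g′ y ≡ g y
    off-x y y≢x = updateAt-minimal y x {pred} g y≢x
    cases : Dec (a ≡ x) → Dec (b ≡ x) → d a b ≤ g′ a + g′ b
    cases (yes refl) (yes refl) = subst (_≤ g′ x + g′ x) (≡-sym (dist-self x)) z≤n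
    cases (yes refl) (no  b≢x) =
      subst (d x b ≤_) (≡-sym (cong₂ _+_ at-x (off-x b b≢x))) (slack g x dom ¬tight b)
    cases (no  a≢x) (yes refl) =
      subst₂ _≤_ (dist-sym x a) (≡-sym (trans (cong₂ _+_ (off-x a a≢x) at-x) (+-comm (g a) (pred (g x)))))
        (slack g x dom ¬tight a)
    cases (no  a≢x) (no  b≢x) =
      subst (d a b ≤_) (≡-sym (cong₂ _+_ (off-x a a≢x) (off-x b b≢x))) (dom a b)

  -- Lowering a non-tight (hence positive) coordinate strictly decreases the sum.
  lowerAt-< : ∀ g x → ¬ Tight g x → sumFin (lowerAt g x) < sumFin g
  lowerAt-< g x ¬tight = sumFin-mono-< (lowerAt g x) g (lowerAt-≤ g x) x gx′<gx
    where
    gx′<gx : lowerAt g x x < g x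
    gx′<gx = subst (_< g x) (≡-sym (updateAt-updates x g)) (pred-< (nonTight⇒nonZero g x ¬tight))

  -- Lower non-tight coordinates until all are tight; the fuel N bounds the sum.
  tighten : ∀ N g → sumFin g < N → Dominating g →
            Σ (HullVertex d) λ h → ∀ x → f h x ≤ g x
  tighten (suc N) g (s≤s sum≤N) dom with all? (tight? g)
  ... | yes allTight = record { f = g ; lower = dom ; tight = allTight } , λ _ → ≤-refl
  ... | no  notAll with ¬∀⟶∃¬ n _ (tight? g) notAll
  ...   | x , ¬tight with tighten N (lowerAt g x) (≤-trans (lowerAt-< g x ¬tight) sum≤N)
                                  (lowerAt-dominating g x dom ¬tight)
  ...     | h , h≤g′ = h , λ y → ≤-trans (h≤g′ y) (lowerAt-≤ g x y)

  hullBelow : ∀ g → Dominating g → Σ (HullVertex d) λ h → ∀ x → f h x ≤ g x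
  hullBelow g = tighten (suc (sumFin g)) g ≤-refl

HullClose : ∀ {n} → (Fin n → Fin n → ℕ) → ℕ → Set
HullClose d α = ∀ (h : HullVertex d) → ∃[ v ] (hullDistToReal h v ≤ α)

module Characterisation {n : ℕ} (G : Graph n) (d : Fin n → Fin n → ℕ) (isD : IsDistance G d) where
  open ShortestPaths G d isD
  open Tightening d dist-self dist-sym

  -- A hull vertex h whose disks D(y, h y + α) all contain w is within α of w:
  -- by tightness h x + h y = d x y ≤ d w x + d w y ≤ d w x + h y + α.
  close-to-common-point : ∀ (h : HullVertex d) w α →
                          (∀ y → d y w ≤ f h y + α) → hullDistToReal h w ≤ α
  close-to-common-point h w α inDisks =
    supDist-≤ (f h) (d w) λ x →
      ≤+⇒∣-∣≤ (above x) (subst (_≤ f h x + α) (dist-sym x w) (inDisks x))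
    where
    open ≤-Reasoning
    above : ∀ x → f h x ≤ d w x + α
    above x with tight h x
    ... | y , hx+hy≡dxy = +-cancelʳ-≤ (f h y) (f h x) (d w x + α) (begin
      f h x + f h y          ≡⟨ hx+hy≡dxy ⟩
      d x y                  ≤⟨ triangle x w y ⟩
      d x w + d w y          ≤⟨ +-mono-≤ (≤-reflexive (dist-sym x w))
                                         (subst (_≤ f h y + α) (dist-sym y w) (inDisks y)) ⟩
      d w x + (f h y + α)    ≡⟨ cong (d w x +_) (+-comm (f h y) α) ⟩
      d w x + (α + f h y)    ≡⟨ +-assoc (d w x) α (f h y) ⟨
      d w x + α + f h y      ∎)

  -- The disks D(v, h v) of a hull vertex h pairwise meet; a point in all the
  -- enlarged disks D(v, h v + α) is a real vertex within α of h.
  weaklyHelly⇒hullClose : ∀ α → WeaklyHelly d α → HullClose d α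
  weaklyHelly⇒hullClose α wh h
    with wh ⊤ (f h) (λ u v _ _ → disks-meet u v (f h u) (f h v) (lower h u v))
  ... | w , inDisks = w , close-to-common-point h w α (λ y → inDisks y ∈⊤)

  -- The radii r on S, extended outside S by a bound on all distances from x.
  extendRadii : Subset n → (Fin n → ℕ) → Fin n → ℕ
  extendRadii S r x with x ∈? S
  ... | yes _ = r x
  ... | no  _ = sumFin (d x)

  extendRadii-∈ : ∀ S r x → x ∈ S → extendRadii S r x ≡ r x
  extendRadii-∈ S r x x∈S with x ∈? S
  ... | yes _   = refl
  ... | no  x∉S = contradiction x∈S x∉S

  extendRadii-dominating : ∀ S r →
    (∀ u v → u ∈ S → v ∈ S → ∃[ w ] (InDisk d u (r u) w × InDisk d v (r v) w)) →
    Dominating (extendRadii S r)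
  extendRadii-dominating S r meet a b with a ∈? S | b ∈? S
  ... | yes a∈S | yes b∈S with meet a b a∈S b∈S
  ...   | w , aw≤ra , bw≤rb =
          ≤-trans (triangle a w b) (+-mono-≤ aw≤ra (subst (_≤ r b) (dist-sym b w) bw≤rb))
  extendRadii-dominating S r meet a b | yes _ | no _ =
    ≤-trans (≤-trans (≤-reflexive (dist-sym a b)) (≤-sumFin (d b) a)) (m≤n+m _ _)
  extendRadii-dominating S r meet a b | no _ | _ = ≤-trans (≤-sumFin (d a) b) (m≤m+n _ _)

  -- A real vertex within α of a hull vertex below the radii lies in every
  -- enlarged disk D(s, r s + α), s ∈ S.
  hullClose⇒weaklyHelly : ∀ α → HullClose d α → WeaklyHelly d α
  hullClose⇒weaklyHelly α close S r meet
    with hullBelow (extendRadii S r) (extendRadii-dominating S r meet)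
  ... | h , h≤g with close h
  ...   | v , hv≤α = v , λ s s∈S →
          ≤-trans (≤-reflexive (dist-sym s v))
            (≤-trans (∣-∣≤⇒≤+ (supDist-≥ (f h) (d v) hv≤α s))
              (+-monoˡ-≤ α (≤-trans (h≤g s) (≤-reflexive (extendRadii-∈ S r s s∈S)))))

theorem1 : ∀ {n} (G : Graph n) → Connected G →
             (d : Fin n → Fin n → ℕ) → IsDistance G d →
             (α : ℕ) →
             WeaklyHelly d α ⇔ (∀ (h : HullVertex d) → ∃[ v ] (hullDistToReal h v ≤ α))
theorem1 G _ d isD α = mk⇔ (weaklyHelly⇒hullClose α) (hullClose⇒weaklyHelly α)
  where open Characterisation G d isD
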